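{- Let $q$ be a prime power with $q\equiv5\pmod 8$. If $(a_n,b_n)\in S_{\mathbb{F}_q}^{\mathrm{back}_2}$, then exactly one of the parents of $(a_n,b_n)$ lies in $S_{\mathbb{F}_q}^{\mathrm{back}_2}$ (so in particular $(a_n,b_n)\in S_{\mathbb{F}_q}^{\mathrm{back}_3}$).
   Context: For a field $K$ of characteristic not $2$: $S_K=\{(\alpha,\beta)\in K^2:\alpha,\beta,\alpha+\beta,\alpha-\beta\neq 0\}$. For $(\alpha,\beta),(\gamma,\delta)\in S_K$ write $(\alpha,\beta)\mapsto(\gamma,\delta)$, and call $(\alpha,\beta)$ a parent of $(\gamma,\delta)$, if $2\gamma=\alpha+\beta$ and $\delta^2=\alpha\beta$. For $n\ge0$, $S_K^{\mathrm{back}_n}$ is the set of $x_0\in S_K$ admitting $x_{ -1},\dots,x_{ -n}\in S_K$ with $x_{ -n}\mapsto\cdots\mapsto x_{ -1}\mapsto x_0$. -}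

module Defs where

open import Level using (Level; _⊔_; suc)
open import Algebra.Bundles using (CommutativeRing)
open import Data.Nat using (ℕ; zero; suc; _^_; _≥_)
open import Data.Nat.Primality using (Prime)
open import Data.Product using (Σ; ∃; _×_; _,_)
open import Relation.Nullary using (¬_)
open import Relation.Binary.PropositionalEquality using (_≡_)

record Field (c ℓ : Level) : Set (Level.suc (c ⊔ ℓ)) where
  field
    commRing : CommutativeRing c ℓ
  open CommutativeRing commRing public
  field
    1≉0     : ¬ (1# ≈ 0#)
    inverse : ∀ x → ¬ (x ≈ 0#) → ∃ λ y → (x * y) ≈ 1#

IsPrimePower : ℕ → Set
IsPrimePower q = Σ ℕ λ p → Σ ℕ λ k → Prime p × k ≥ 1 × q ≡ p ^ k

module FieldDefs {c ℓ} (K : Field c ℓ) where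
  open Field K

  Pair : Set c
  Pair = Carrier × Carrier

  _≈ₚ_ : Pair → Pair → Set ℓ
  (α , β) ≈ₚ (γ , δ) = (α ≈ γ) × (β ≈ δ)

  S : Pair → Set ℓ
  S (α , β) = ¬ (α ≈ 0#) × ¬ (β ≈ 0#) × ¬ ((α + β) ≈ 0#) × ¬ ((α - β) ≈ 0#)

  _↦_ : Pair → Pair → Set ℓ
  (α , β) ↦ (γ , δ) = ((γ + γ) ≈ (α + β)) × ((δ * δ) ≈ (α * β))

  Back : ℕ → Pair → Set (c ⊔ ℓ)
  Back zero    x = Level.Lift c (S x)
  Back (suc n) x = S x × ∃ λ y → Back n y × (y ↦ x)

  Parent : Pair → Pair → Set ℓ
  Parent y x = S y × S x × (y ↦ x)

-- A parent (a, b) of (α, β) satisfies a + b = 2α and ab = β², so it is (α + t, α − t) with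
-- t² = Δ(α, β) := α² − β². Hence (α, β) ∈ S^back₁ iff Δ(α, β) is a square and, as
-- Δ(α + t, α − t) = 4αt, (α, β) ∈ S^back₂ iff αt is a square; when −1 is a square this does
-- not depend on the sign of t. The parents of (γ, δ) are (α, β) and (β, α). If i² = −1 then it
-- is a root of Δ(β, α) = −Δ(α, β), and (αt)(β·it) = (δt)²·i. For q ≡ 5 (mod 8), −1 is a square
-- but i is not, and a product of two nonsquares is a square, so exactly one of αt and β·it is a
-- square. These facts come from Euler's criterion (u^((q−1)/2) is −1 for a nonsquare u and 1 for
-- a nonzero square), obtained by pairing each nonzero x with u/x in the product of all nonzero
-- elements, Wilson's theorem being the case u = 1.
module Submission where

open import Defs
open import Algebra.Bundles using (CommutativeRing; CommutativeSemiring)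
open import Algebra.Solver.Ring.AlmostCommutativeRing
  using (_-Raw-AlmostCommutative⟶_; fromCommutativeRing)
open import Data.Empty using (⊥; ⊥-elim)
open import Data.Fin.Base using (Fin)
import Data.Fin.Properties as Fin
open import Data.Integer.Base as ℤ using (ℤ; +_; -[1+_]; _⊖_; _◃_)
import Data.Integer.Properties as ℤ
open import Data.List.Base using (List; []; _∷_; _++_; length; map; foldr; allFin)
open import Data.List.Membership.Propositional using (_∈_; _∉_)
open import Data.List.Membership.Propositional.Properties using (∈-∃++; ∈-++⁺ʳ; ∈-allFin)
open import Data.List.Properties using (length-tabulate)
open import Data.List.Relation.Binary.Permutation.Propositional
  using (_↭_; prep; ↭-sym; ↭-trans; ↭⇒↭ₛ; ↭⇒↭ₛ′)
open import Data.List.Relation.Binary.Permutation.Propositional.Properties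
  using (∈-resp-↭; shift; map⁺; ↭-length)
import Data.List.Relation.Binary.Permutation.Setoid.Properties as ↭ₛ
open import Data.List.Relation.Binary.Subset.Propositional using (_⊆_)
open import Data.List.Relation.Unary.Any using (here; there)
open import Data.List.Relation.Unary.AllPairs using (_∷_)
open import Data.List.Relation.Unary.Unique.Propositional using (Unique)
open import Data.List.Relation.Unary.Unique.Propositional.Properties
  using (allFin⁺; Unique[x∷xs]⇒x∉xs)
open import Data.Maybe.Base using (Maybe; just; nothing)
open import Data.Nat.Base as ℕ using (ℕ; zero; suc; _%_; _/_)
import Data.Nat.Properties as ℕ
open import Data.Nat.DivMod using (m≡m%n+[m/n]*n)
open import Data.Nat.Tactic.RingSolver using (solve-∀)
open import Data.Product.Base using (Σ; ∃; _×_; _,_; proj₁; proj₂)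
open import Data.Sign.Base as Sign using (Sign)
open import Data.Sum.Base using (_⊎_; inj₁; inj₂)
open import Function.Base using (_∘_)
open import Function.Bundles using (Inverse; Injection)
import Function.Construct.Symmetry as Symmetry
open import Function.Properties.Inverse using (Inverse⇒Injection)
open import Level using (lift)
open import Relation.Binary.Definitions using (Decidable)
open import Relation.Binary.PropositionalEquality as ≡ using (_≡_; _≢_)
open import Relation.Nullary.Decidable using (Dec; yes; no; map′; via-injection)
open import Relation.Nullary.Negation using (¬_)

-- Algebra.Solver.Ring needs a coefficient ring mapped into R; ℤ, via n ↦ n · 1#, serves every
-- commutative ring. With the TC-optimised _·_, ⟦ con (+ 2) ⟧ reduces to exactly 1# + 1#.
module ℤ-RingSolver {c ℓ} (R : CommutativeRing c ℓ) where
  open CommutativeRing R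
  open import Algebra.Properties.Semiring.Mult.TCOptimised semiring renaming (_×_ to _·_)
  open import Algebra.Properties.Ring ring
    using (-0#≈0#; -‿distribˡ-*; -‿distribʳ-*; -‿involutive; -‿+-comm)
  open import Relation.Binary.Reasoning.Setoid setoid

  fromℤ : ℤ → Carrier
  fromℤ (+ n)    = n · 1#
  fromℤ -[1+ n ] = - (suc n · 1#)

  signed : Sign → Carrier → Carrier
  signed Sign.+ x = x
  signed Sign.- x = - x

  signed-cong : ∀ s {x y} → x ≈ y → signed s x ≈ signed s y
  signed-cong Sign.+ x≈y = x≈y
  signed-cong Sign.- x≈y = -‿cong x≈y

  signed-* : ∀ s t x y → signed (s Sign.* t) (x * y) ≈ signed s x * signed t y
  signed-* Sign.+ Sign.+ x y = refl
  signed-* Sign.+ Sign.- x y = -‿distribʳ-* x y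
  signed-* Sign.- Sign.+ x y = -‿distribˡ-* x y
  signed-* Sign.- Sign.- x y =
    trans (sym (-‿involutive _)) (trans (-‿cong (-‿distribˡ-* x y)) (-‿distribʳ-* (- x) y))

  fromℤ≈signed : ∀ i → fromℤ i ≈ signed (ℤ.sign i) (ℤ.∣ i ∣ · 1#)
  fromℤ≈signed (+ n)    = refl
  fromℤ≈signed -[1+ n ] = refl

  fromℤ-◃ : ∀ s n → fromℤ (s ◃ n) ≈ signed s (n · 1#)
  fromℤ-◃ Sign.+ zero    = refl
  fromℤ-◃ Sign.- zero    = sym -0#≈0#
  fromℤ-◃ Sign.+ (suc n) = refl
  fromℤ-◃ Sign.- (suc n) = refl

  fromℤ-⊖ : ∀ m n → fromℤ (m ⊖ n) ≈ m · 1# - n · 1#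
  fromℤ-⊖ zero    zero    = sym (-‿inverseʳ 0#)
  fromℤ-⊖ zero    (suc n) = sym (+-identityˡ _)
  fromℤ-⊖ (suc m) zero    = sym (trans (+-congˡ -0#≈0#) (+-identityʳ _))
  fromℤ-⊖ (suc m) (suc n) = begin
    fromℤ (suc m ⊖ suc n)      ≡⟨ ≡.cong fromℤ (ℤ.[1+m]⊖[1+n]≡m⊖n m n) ⟩
    fromℤ (m ⊖ n)              ≈⟨ fromℤ-⊖ m n ⟩
    M - N                      ≈⟨ +-congʳ (+-identityˡ M) ⟨
    (0# + M) - N               ≈⟨ +-congʳ (+-congʳ (-‿inverseʳ 1#)) ⟨
    ((1# - 1#) + M) - N        ≈⟨ +-congʳ (+-assoc 1# (- 1#) M) ⟩
    (1# + (- 1# + M)) - N      ≈⟨ +-congʳ (+-congˡ (+-comm (- 1#) M)) ⟩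
    (1# + (M - 1#)) - N        ≈⟨ +-assoc 1# (M - 1#) (- N) ⟩
    1# + ((M - 1#) - N)        ≈⟨ +-congˡ (+-assoc M (- 1#) (- N)) ⟩
    1# + (M + (- 1# - N))      ≈⟨ +-congˡ (+-congˡ (-‿+-comm 1# N)) ⟩
    1# + (M - (1# + N))        ≈⟨ +-assoc 1# M (- (1# + N)) ⟨
    (1# + M) - (1# + N)        ≈⟨ +-cong (1+× m 1#) (-‿cong (1+× n 1#)) ⟨
    suc m · 1# - suc n · 1#    ∎
    where
    M N : Carrier
    M = m · 1#
    N = n · 1#

  fromℤ-+ : ∀ i j → fromℤ (i ℤ.+ j) ≈ fromℤ i + fromℤ j
  fromℤ-+ (+ m)    (+ n)    = ×-homo-+ 1# m n
  fromℤ-+ (+ m)    -[1+ n ] = fromℤ-⊖ m (suc n)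
  fromℤ-+ -[1+ m ] (+ n)    = trans (fromℤ-⊖ n (suc m)) (+-comm _ _)
  fromℤ-+ -[1+ m ] -[1+ n ] = begin
    - (suc (suc m ℕ.+ n) · 1#)     ≡⟨ ≡.cong (λ k → - (k · 1#)) (ℕ.+-suc (suc m) n) ⟨
    - ((suc m ℕ.+ suc n) · 1#)     ≈⟨ -‿cong (×-homo-+ 1# (suc m) (suc n)) ⟩
    - (suc m · 1# + suc n · 1#)    ≈⟨ -‿+-comm _ _ ⟨
    - (suc m · 1#) - (suc n · 1#)  ∎

  fromℤ-neg : ∀ i → fromℤ (ℤ.- i) ≈ - fromℤ i
  fromℤ-neg (+ zero)  = sym -0#≈0#
  fromℤ-neg (+ suc n) = refl
  fromℤ-neg -[1+ n ]  = sym (-‿involutive _)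

  fromℤ-* : ∀ i j → fromℤ (i ℤ.* j) ≈ fromℤ i * fromℤ j
  fromℤ-* i j = begin
    fromℤ (i ℤ.* j)                            ≈⟨ fromℤ-◃ (s Sign.* t) (m ℕ.* n) ⟩
    signed (s Sign.* t) ((m ℕ.* n) · 1#)       ≈⟨ signed-cong (s Sign.* t) (×1-homo-* m n) ⟩
    signed (s Sign.* t) ((m · 1#) * (n · 1#))  ≈⟨ signed-* s t _ _ ⟩
    signed s (m · 1#) * signed t (n · 1#)      ≈⟨ *-cong (fromℤ≈signed i) (fromℤ≈signed j) ⟨
    fromℤ i * fromℤ j                          ∎
    where
    s t : Sign
    s = ℤ.sign i
    t = ℤ.sign j
    m n : ℕ
    m = ℤ.∣ i ∣
    n = ℤ.∣ j ∣

  homomorphism : ℤ.+-*-rawRing -Raw-AlmostCommutative⟶ fromCommutativeRing R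
  homomorphism = record
    { ⟦_⟧    = fromℤ
    ; +-homo = fromℤ-+
    ; *-homo = fromℤ-*
    ; -‿homo = fromℤ-neg
    ; 0-homo = refl
    ; 1-homo = refl
    }

  fromℤ-≟ : ∀ i j → Maybe (fromℤ i ≈ fromℤ j)
  fromℤ-≟ i j with i ℤ.≟ j
  ... | yes ≡.refl = just refl
  ... | no _       = nothing

  open import Algebra.Solver.Ring ℤ.+-*-rawRing (fromCommutativeRing R) homomorphism fromℤ-≟ public

module Powers {c ℓ} (R : CommutativeRing c ℓ) where
  open CommutativeRing R
  open ℤ-RingSolver R using (solve; _:=_; _:*_; :-_; con)
  open import Algebra.Properties.Semiring.Exp semiring using (_^_; ^-homo-*; ^-congˡ)
  open import Algebra.Properties.CommutativeSemiring.Exp commutativeSemiring using (^-distrib-*)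

  1^n≈1 : ∀ n → 1# ^ n ≈ 1#
  1^n≈1 zero    = refl
  1^n≈1 (suc n) = trans (*-identityˡ _) (1^n≈1 n)

  ^-double : ∀ x m → x ^ (m ℕ.+ m) ≈ (x * x) ^ m
  ^-double x m = trans (^-homo-* x m m) (sym (^-distrib-* x x m))

  -1^even : ∀ m → (- 1#) ^ (m ℕ.+ m) ≈ 1#
  -1^even m = trans (^-double (- 1#) m)
    (trans (^-congˡ m (solve 0 (:- con (+ 1) :* :- con (+ 1) := con (+ 1)) refl)) (1^n≈1 m))

  -1^odd : ∀ m → (- 1#) ^ suc (m ℕ.+ m) ≈ - 1#
  -1^odd m = trans (*-congˡ (-1^even m)) (*-identityʳ (- 1#))

module ListPermutation {a} {A : Set a} where
  open ≡ using (refl)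

  private
    variable
      x y z : A
      xs ys : List A

  ∈⇒↭∷ : x ∈ xs → ∃ λ ys → xs ↭ x ∷ ys
  ∈⇒↭∷ {x} x∈xs with ys , zs , refl ← ∈-∃++ x∈xs = ys ++ zs , shift x ys zs

  ∈⇒↭∷∷ : x ∈ xs → y ∈ xs → x ≢ y → ∃ λ zs → xs ↭ x ∷ y ∷ zs
  ∈⇒↭∷∷ {x} x∈xs y∈xs x≢y with ys , p ← ∈⇒↭∷ x∈xs | ∈-resp-↭ p y∈xs
  ... | here y≡x   = ⊥-elim (x≢y (≡.sym y≡x))
  ... | there y∈ys with zs , q ← ∈⇒↭∷ y∈ys = zs , ↭-trans p (prep x q)

  drop₂-⊆ : xs ↭ x ∷ y ∷ ys → ys ⊆ xs
  drop₂-⊆ p z∈ys = ∈-resp-↭ (↭-sym p) (there (there z∈ys))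

  length-drop₂ : ∀ n → xs ↭ x ∷ y ∷ ys → length xs ≡ suc n ℕ.+ suc n → length ys ≡ n ℕ.+ n
  length-drop₂ n p len = ℕ.suc-injective (ℕ.suc-injective
    (≡.trans (≡.sym (↭-length p)) (≡.trans len (≡.cong suc (ℕ.+-suc n n)))))

  Unique-resp-↭ : xs ↭ ys → Unique xs → Unique ys
  Unique-resp-↭ p = ↭ₛ.Unique-resp-↭ (≡.setoid A) (↭⇒↭ₛ p)

  Unique-drop₂ : Unique xs → xs ↭ x ∷ y ∷ ys → Unique ys
  Unique-drop₂ u p with _ ∷ _ ∷ u′ ← Unique-resp-↭ p u = u′

  Unique-++⇒∉ : ∀ xs → Unique (xs ++ ys) → z ∈ ys → z ∉ xs
  Unique-++⇒∉ (x ∷ xs) u       z∈ys (here refl)  = Unique[x∷xs]⇒x∉xs u (∈-++⁺ʳ xs z∈ys)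
  Unique-++⇒∉ (x ∷ xs) (_ ∷ u) z∈ys (there z∈xs) = Unique-++⇒∉ xs u z∈ys z∈xs

open ListPermutation

module ListProduct {c ℓ} (R : CommutativeSemiring c ℓ) {a} {A : Set a}
                   (f : A → CommutativeSemiring.Carrier R) where
  open CommutativeSemiring R
    using (Carrier; _≈_; _*_; 1#; setoid; isEquivalence; semiring; *-isCommutativeMonoid; *-assoc; *-cong)
    renaming (refl to ≈-refl)
  open import Algebra.Properties.Semiring.Exp semiring using (_^_)
  open import Relation.Binary.Reasoning.Setoid setoid
  open ≡ using (refl)

  ∏ : List A → Carrier
  ∏ xs = foldr _*_ 1# (map f xs)

  ∏-↭ : ∀ {xs ys} → xs ↭ ys → ∏ xs ≈ ∏ ys
  ∏-↭ p = ↭ₛ.foldr-commMonoid setoid *-isCommutativeMonoid (↭⇒↭ₛ′ isEquivalence (map⁺ f p))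

  module Pairing (τ : A → A) where

    record Involution (xs : List A) : Set a where
      field
        closed     : ∀ {x} → x ∈ xs → τ x ∈ xs
        involutive : ∀ {x} → x ∈ xs → τ (τ x) ≡ x

    Involution-drop₂ : ∀ {x y xs ys} → Unique xs → xs ↭ x ∷ y ∷ ys →
                       τ x ∈ x ∷ y ∷ [] → τ y ∈ x ∷ y ∷ [] → Involution xs → Involution ys
    Involution-drop₂ {x} {y} {xs} {ys} u p τx∈ τy∈ inv = record
      { closed     = closed
      ; involutive = involutive ∘ drop₂-⊆ p
      }
      where
      open Involution inv using (involutive)
      no-return : ∀ {z w} → z ∈ ys → τ z ≡ w → τ w ∈ x ∷ y ∷ [] → ⊥
      no-return z∈ys refl τw∈ = Unique-++⇒∉ (x ∷ y ∷ []) (Unique-resp-↭ p u) z∈ys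
        (≡.subst (_∈ x ∷ y ∷ []) (involutive (drop₂-⊆ p z∈ys)) τw∈)
      closed : ∀ {z} → z ∈ ys → τ z ∈ ys
      closed z∈ys with ∈-resp-↭ p (Involution.closed inv (drop₂-⊆ p z∈ys))
      ... | here τz≡x           = ⊥-elim (no-return z∈ys τz≡x τx∈)
      ... | there (here τz≡y)   = ⊥-elim (no-return z∈ys τz≡y τy∈)
      ... | there (there τz∈ys) = τz∈ys

    ∏-pairing : ∀ u n {xs} → length xs ≡ n ℕ.+ n → Unique xs → Involution xs →
                (∀ {x} → x ∈ xs → τ x ≢ x) → (∀ {x} → x ∈ xs → f x * f (τ x) ≈ u) →
                ∏ xs ≈ u ^ n
    ∏-pairing u zero    {[]}     _   _    _   _      _    = ≈-refl
    ∏-pairing u (suc n) {x ∷ xs} len uniq inv no-fix pair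
      with ys , p ← ∈⇒↭∷∷ (here refl) (Involution.closed inv (here refl)) (≡.≢-sym (no-fix (here refl))) =
      begin
        ∏ (x ∷ xs)              ≈⟨ ∏-↭ p ⟩
        f x * (f (τ x) * ∏ ys)  ≈⟨ *-assoc _ _ _ ⟨
        (f x * f (τ x)) * ∏ ys  ≈⟨ *-cong (pair (here refl)) ∏ys ⟩
        u * u ^ n               ∎
      where
      inv′ : Involution ys
      inv′ = Involution-drop₂ uniq p (there (here refl)) (here (Involution.involutive inv (here refl))) inv
      ∏ys : ∏ ys ≈ u ^ n
      ∏ys = ∏-pairing u n (length-drop₂ n p len) (Unique-drop₂ uniq p) inv′
                      (no-fix ∘ drop₂-⊆ p) (pair ∘ drop₂-⊆ p)

module FieldProperties {c ℓ} (K : Field c ℓ) where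
  open Field K
  open ℤ-RingSolver commRing using (solve; _:=_; _:+_; _:*_; _:-_; con)
  open import Algebra.Properties.Group +-group using (x∙y⁻¹≈ε⇒x≈y)
  open import Algebra.Properties.Ring ring using (-‿involutive; -0#≈0#)
  open import Relation.Binary.Reasoning.Setoid setoid

  2# : Carrier
  2# = 1# + 1#

  *-cancelˡ : ∀ {x y z} → x ≉ 0# → x * y ≈ x * z → y ≈ z
  *-cancelˡ {x} {y} {z} x≉0 xy≈xz with x⁻¹ , xx⁻¹≈1 ← inverse x x≉0 = begin
    y               ≈⟨ *-identityˡ y ⟨
    1# * y          ≈⟨ *-congʳ xx⁻¹≈1 ⟨
    (x * x⁻¹) * y   ≈⟨ solve 3 (λ x i y → (x :* i) :* y := i :* (x :* y)) refl x x⁻¹ y ⟩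
    x⁻¹ * (x * y)   ≈⟨ *-congˡ xy≈xz ⟩
    x⁻¹ * (x * z)   ≈⟨ solve 3 (λ x i z → i :* (x :* z) := (x :* i) :* z) refl x x⁻¹ z ⟩
    (x * x⁻¹) * z   ≈⟨ *-congʳ xx⁻¹≈1 ⟩
    1# * z          ≈⟨ *-identityˡ z ⟩
    z               ∎

  *-≉0 : ∀ {x y} → x ≉ 0# → y ≉ 0# → x * y ≉ 0#
  *-≉0 {x} x≉0 y≉0 xy≈0 = y≉0 (*-cancelˡ x≉0 (trans xy≈0 (sym (zeroʳ x))))

  *-≉0⇒≉0ˡ : ∀ {x y} → x * y ≉ 0# → x ≉ 0#
  *-≉0⇒≉0ˡ {x} {y} xy≉0 x≈0 = xy≉0 (trans (*-congʳ x≈0) (zeroˡ y))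

  *-≉0⇒≉0ʳ : ∀ {x y} → x * y ≉ 0# → y ≉ 0#
  *-≉0⇒≉0ʳ {x} {y} xy≉0 = *-≉0⇒≉0ˡ (λ yx≈0 → xy≉0 (trans (*-comm x y) yx≈0))

  -‿≉0 : ∀ {x} → x ≉ 0# → - x ≉ 0#
  -‿≉0 {x} x≉0 -x≈0 = x≉0 (trans (sym (-‿involutive x)) (trans (-‿cong -x≈0) -0#≈0#))

  x≉-x : ∀ {x} → 2# ≉ 0# → x ≉ 0# → x ≉ - x
  x≉-x {x} 2≉0 x≉0 x≈-x = *-≉0 2≉0 x≉0 (begin
    2# * x   ≈⟨ solve 1 (λ x → con (+ 2) :* x := x :+ x) refl x ⟩
    x + x    ≈⟨ +-congˡ x≈-x ⟩
    x - x    ≈⟨ -‿inverseʳ x ⟩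
    0#       ∎)

  x-y≈0⇒x≈y : ∀ {x y} → x - y ≈ 0# → x ≈ y
  x-y≈0⇒x≈y = x∙y⁻¹≈ε⇒x≈y _ _

  IsSquare : Carrier → Set (c Level.⊔ ℓ)
  IsSquare x = ∃ λ s → s * s ≈ x

  IsSquare-resp-≈ : ∀ {x y} → x ≈ y → IsSquare x → IsSquare y
  IsSquare-resp-≈ x≈y (s , s²≈x) = s , trans s²≈x x≈y

  IsSquare-* : ∀ {x y} → IsSquare x → IsSquare y → IsSquare (x * y)
  IsSquare-* (s , s²≈x) (t , t²≈y) =
    s * t , trans (solve 2 (λ s t → (s :* t) :* (s :* t) := (s :* s) :* (t :* t)) refl s t) (*-cong s²≈x t²≈y)

  IsSquare-cancelˡ : ∀ {c x} → c ≉ 0# → IsSquare ((c * c) * x) → IsSquare x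
  IsSquare-cancelˡ {c} {x} c≉0 (s , s²≈c²x) with c⁻¹ , cc⁻¹≈1 ← inverse c c≉0 = s * c⁻¹ , (begin
    (s * c⁻¹) * (s * c⁻¹)        ≈⟨ solve 2 (λ s i → (s :* i) :* (s :* i) := (s :* s) :* (i :* i)) refl s c⁻¹ ⟩
    (s * s) * (c⁻¹ * c⁻¹)        ≈⟨ *-congʳ s²≈c²x ⟩
    ((c * c) * x) * (c⁻¹ * c⁻¹)  ≈⟨ solve 3 (λ c x i → ((c :* c) :* x) :* (i :* i) := ((c :* i) :* (c :* i)) :* x) refl c x c⁻¹ ⟩
    ((c * c⁻¹) * (c * c⁻¹)) * x  ≈⟨ *-congʳ (*-cong cc⁻¹≈1 cc⁻¹≈1) ⟩
    (1# * 1#) * x                ≈⟨ solve 1 (λ x → (con (+ 1) :* con (+ 1)) :* x := x) refl x ⟩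
    x                            ∎)

  module WithDecidableEquality (_≟_ : Decidable _≈_) where

    *≈0⇒ : ∀ {x y} → x * y ≈ 0# → x ≈ 0# ⊎ y ≈ 0#
    *≈0⇒ {x} xy≈0 with x ≟ 0#
    ... | yes x≈0 = inj₁ x≈0
    ... | no  x≉0 = inj₂ (*-cancelˡ x≉0 (trans xy≈0 (sym (zeroʳ x))))

    square-roots : ∀ {x y} → x * x ≈ y * y → x ≈ y ⊎ x ≈ - y
    square-roots {x} {y} x²≈y² with *≈0⇒ (begin
        (x - y) * (x + y)  ≈⟨ solve 2 (λ x y → (x :- y) :* (x :+ y) := x :* x :- y :* y) refl x y ⟩
        x * x - y * y      ≈⟨ +-congʳ x²≈y² ⟩
        y * y - y * y      ≈⟨ -‿inverseʳ _ ⟩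
        0#                 ∎)
    ... | inj₁ x-y≈0 = inj₁ (x-y≈0⇒x≈y x-y≈0)
    ... | inj₂ x+y≈0 = inj₂ (x-y≈0⇒x≈y (trans (+-congˡ (-‿involutive y)) x+y≈0))

module FiniteField {c ℓ} (K : Field c ℓ) {q} (enum : Inverse (≡.setoid (Fin q)) (Field.setoid K)) where
  open Field K
  open FieldProperties K
  open ℤ-RingSolver commRing using (solve; _:=_; _:*_; :-_; con)
  open import Algebra.Properties.Semiring.Exp semiring using (_^_; ^-congˡ)
  open import Relation.Binary.Reasoning.Setoid setoid
  open Inverse enum using (to; from; strictlyInverseˡ)
  open Injection (Inverse⇒Injection enum) using () renaming (injective to to-injective)
  open ListProduct commutativeSemiring to
  open Pairing

  infix 4 _≟_
  _≟_ : Decidable _≈_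
  _≟_ = via-injection (Inverse⇒Injection (Symmetry.inverse enum)) Fin._≟_

  open WithDecidableEquality _≟_ public

  IsSquare? : ∀ x → Dec (IsSquare x)
  IsSquare? x = map′ (λ (i , i²≈x) → to i , i²≈x)
                     (λ (s , s²≈x) → from s , trans (*-cong (strictlyInverseˡ s) (strictlyInverseˡ s)) s²≈x)
                     (Fin.any? (λ i → to i * to i ≟ x))

  to≈⇒≡from : ∀ {i x} → to i ≈ x → i ≡ from x
  to≈⇒≡from {i} {x} e = to-injective (trans e (sym (strictlyInverseˡ x)))

  to-from-≉0 : ∀ {x} → x ≉ 0# → to (from x) ≉ 0#
  to-from-≉0 x≉0 e = x≉0 (trans (sym (strictlyInverseˡ _)) e)

  nonzeros : List (Fin q)
  nonzeros = proj₁ (∈⇒↭∷ (∈-allFin (from 0#)))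

  allFin↭ : allFin q ↭ from 0# ∷ nonzeros
  allFin↭ = proj₂ (∈⇒↭∷ (∈-allFin (from 0#)))

  Unique-nonzeros : Unique nonzeros
  Unique-nonzeros with _ ∷ u ← Unique-resp-↭ allFin↭ (allFin⁺ q) = u

  length-nonzeros : q ≡ suc (length nonzeros)
  length-nonzeros = ≡.trans (≡.sym (length-tabulate (λ i → i))) (↭-length allFin↭)

  ∈-nonzeros⁺ : ∀ {i} → to i ≉ 0# → i ∈ nonzeros
  ∈-nonzeros⁺ {i} i≉0 with ∈-resp-↭ allFin↭ (∈-allFin i)
  ... | here i≡0   = ⊥-elim (i≉0 (trans (reflexive (≡.cong to i≡0)) (strictlyInverseˡ 0#)))
  ... | there i∈nz = i∈nz

  ∈-nonzeros⁻ : ∀ {i} → i ∈ nonzeros → to i ≉ 0#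
  ∈-nonzeros⁻ i∈nz i≈0 = Unique[x∷xs]⇒x∉xs (Unique-resp-↭ allFin↭ (allFin⁺ q))
                           (≡.subst (_∈ nonzeros) (to≈⇒≡from i≈0) i∈nz)

  -- partner u i is the index of u / to i; its value at the index of 0 is irrelevant.
  partner : Carrier → Fin q → Fin q
  partner u i with to i ≟ 0#
  ... | yes _   = i
  ... | no  i≉0 = from (u * proj₁ (inverse (to i) i≉0))

  partner-product : ∀ u {i} → to i ≉ 0# → to i * to (partner u i) ≈ u
  partner-product u {i} i≉0 with to i ≟ 0#
  ... | yes i≈0 = ⊥-elim (i≉0 i≈0)
  ... | no  i≉0′ with x⁻¹ , xx⁻¹≈1 ← inverse (to i) i≉0′ = begin
    to i * to (from (u * x⁻¹))  ≈⟨ *-congˡ (strictlyInverseˡ _) ⟩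
    to i * (u * x⁻¹)            ≈⟨ solve 3 (λ x u y → x :* (u :* y) := u :* (x :* y)) refl (to i) u x⁻¹ ⟩
    u * (to i * x⁻¹)            ≈⟨ *-congˡ xx⁻¹≈1 ⟩
    u * 1#                      ≈⟨ *-identityʳ u ⟩
    u                           ∎

  module _ {u} (u≉0 : u ≉ 0#) where

    partner-≉0 : ∀ {i} → to i ≉ 0# → to (partner u i) ≉ 0#
    partner-≉0 i≉0 = *-≉0⇒≉0ʳ (λ e → u≉0 (trans (sym (partner-product u i≉0)) e))

    partner-unique : ∀ {i j} → to i ≉ 0# → to i * to j ≈ u → partner u i ≡ j
    partner-unique i≉0 e = to-injective (*-cancelˡ i≉0 (trans (partner-product u i≉0) (sym e)))

    partner-Involution : Involution (partner u) nonzeros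
    partner-Involution = record
      { closed     = ∈-nonzeros⁺ ∘ partner-≉0 ∘ ∈-nonzeros⁻
      ; involutive = λ i∈nz → let i≉0 = ∈-nonzeros⁻ i∈nz in
          partner-unique (partner-≉0 i≉0) (trans (*-comm _ _) (partner-product u i≉0))
      }

  ∏-nonzeros-nonsquare : ∀ {u} N → ¬ IsSquare u → length nonzeros ≡ N ℕ.+ N → ∏ nonzeros ≈ u ^ N
  ∏-nonzeros-nonsquare {u} N ¬□u len =
    ∏-pairing (partner u) u N len Unique-nonzeros (partner-Involution u≉0) no-fix (partner-product u ∘ ∈-nonzeros⁻)
    where
    u≉0 : u ≉ 0#
    u≉0 u≈0 = ¬□u (0# , trans (zeroˡ 0#) (sym u≈0))
    no-fix : ∀ {i} → i ∈ nonzeros → partner u i ≢ i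
    no-fix {i} i∈nz e = ¬□u (to i , trans (*-congˡ (reflexive (≡.cong to (≡.sym e))))
                                          (partner-product u (∈-nonzeros⁻ i∈nz)))

  nonzeros-↭± : ∀ {s} → 2# ≉ 0# → s ≉ 0# → ∃ λ zs → nonzeros ↭ from s ∷ from (- s) ∷ zs
  nonzeros-↭± {s} 2≉0 s≉0 = ∈⇒↭∷∷ (∈-nonzeros⁺ (to-from-≉0 s≉0)) (∈-nonzeros⁺ (to-from-≉0 (-‿≉0 s≉0)))
    (λ e → x≉-x 2≉0 s≉0 (trans (sym (strictlyInverseˡ s)) (trans (reflexive (≡.cong to e)) (strictlyInverseˡ (- s)))))

  ∏-nonzeros-square : ∀ {s} N → 2# ≉ 0# → s ≉ 0# → length nonzeros ≡ N ℕ.+ N → ∏ nonzeros ≈ - ((s * s) ^ N)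
  ∏-nonzeros-square zero 2≉0 s≉0 len with _ , p ← nonzeros-↭± 2≉0 s≉0 =
    ⊥-elim (ℕ.0≢1+n (≡.trans (≡.sym len) (↭-length p)))
  ∏-nonzeros-square {s} (suc n) 2≉0 s≉0 len with zs , p ← nonzeros-↭± 2≉0 s≉0 = begin
    ∏ nonzeros                              ≈⟨ ∏-↭ p ⟩
    to (from s) * (to (from (- s)) * ∏ zs)  ≈⟨ *-cong (strictlyInverseˡ s) (*-cong (strictlyInverseˡ (- s)) ∏zs) ⟩
    s * (- s * u ^ n)                       ≈⟨ solve 2 (λ s w → s :* (:- s :* w) := :- ((s :* s) :* w)) refl s (u ^ n) ⟩
    - (u ^ suc n)                           ∎
    where
    u : Carrier
    u = s * s
    u≉0 : u ≉ 0#
    u≉0 = *-≉0 s≉0 s≉0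
    ±s : List (Fin q)
    ±s = from s ∷ from (- s) ∷ []
    fixed : ∀ {x} → x ≉ 0# → x * x ≈ u → partner u (from x) ≡ from x
    fixed {x} x≉0 x²≈u = partner-unique u≉0 (to-from-≉0 x≉0)
      (trans (*-cong (strictlyInverseˡ x) (strictlyInverseˡ x)) x²≈u)
    roots : ∀ {z} → to z * to z ≈ u → z ∈ ±s
    roots z²≈u with square-roots z²≈u
    ... | inj₁ z≈s  = here (to≈⇒≡from z≈s)
    ... | inj₂ z≈-s = there (here (to≈⇒≡from z≈-s))
    no-fix : ∀ {z} → z ∈ zs → partner u z ≢ z
    no-fix {z} z∈zs e = Unique-++⇒∉ ±s (Unique-resp-↭ p Unique-nonzeros) z∈zs
      (roots (trans (*-congˡ (reflexive (≡.cong to (≡.sym e)))) (partner-product u (∈-nonzeros⁻ (drop₂-⊆ p z∈zs)))))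
    inv : Involution (partner u) zs
    inv = Involution-drop₂ (partner u) Unique-nonzeros p (here (fixed s≉0 refl))
            (there (here (fixed (-‿≉0 s≉0) (solve 1 (λ s → :- s :* :- s := s :* s) refl s))))
            (partner-Involution u≉0)
    ∏zs : ∏ zs ≈ u ^ n
    ∏zs = ∏-pairing (partner u) u n (length-drop₂ n p len) (Unique-drop₂ Unique-nonzeros p) inv
            no-fix (partner-product u ∘ ∈-nonzeros⁻ ∘ drop₂-⊆ p)

  module Euler (2≉0 : 2# ≉ 0#) (N : ℕ) (len : length nonzeros ≡ N ℕ.+ N) where
    open Powers commRing using (1^n≈1)
    open import Algebra.Properties.Group +-group using (⁻¹-injective)

    wilson : ∏ nonzeros ≈ - 1#
    wilson = trans (∏-nonzeros-square N 2≉0 1≉0 len) (-‿cong (trans (^-congˡ N (*-identityˡ 1#)) (1^n≈1 N)))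

    euler-square : ∀ {s} → s ≉ 0# → (s * s) ^ N ≈ 1#
    euler-square s≉0 = ⁻¹-injective (trans (sym (∏-nonzeros-square N 2≉0 s≉0 len)) wilson)

    euler-nonsquare : ∀ {u} → ¬ IsSquare u → u ^ N ≈ - 1#
    euler-nonsquare ¬□u = trans (sym (∏-nonzeros-nonsquare N ¬□u len)) wilson

  module Order≡5mod8 (2≉0 : 2# ≉ 0#) (k : ℕ) (q≡5+8k : q ≡ 5 ℕ.+ k ℕ.* 8) where
    open Powers commRing using (^-double; -1^even; -1^odd)
    open import Algebra.Properties.CommutativeSemiring.Exp commutativeSemiring using (^-distrib-*)

    -- (q − 1)/2 = N = 2h with h odd
    h N : ℕ
    h = suc (k ℕ.+ k)
    N = h ℕ.+ h

    length-nonzeros≡N+N : length nonzeros ≡ N ℕ.+ N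
    length-nonzeros≡N+N = ℕ.suc-injective (≡.trans (≡.sym length-nonzeros) (≡.trans q≡5+8k (arith k)))
      where
      arith : ∀ k → 5 ℕ.+ k ℕ.* 8 ≡ suc ((suc (k ℕ.+ k) ℕ.+ suc (k ℕ.+ k)) ℕ.+ (suc (k ℕ.+ k) ℕ.+ suc (k ℕ.+ k)))
      arith = solve-∀

    open Euler 2≉0 N length-nonzeros≡N+N

    1≉-1 : 1# ≉ - 1#
    1≉-1 = x≉-x 2≉0 1≉0

    -1-IsSquare : IsSquare (- 1#)
    -1-IsSquare with IsSquare? (- 1#)
    ... | yes □ = □
    ... | no ¬□ = ⊥-elim (1≉-1 (trans (sym (-1^even h)) (euler-nonsquare ¬□)))

    nonsquare*nonsquare : ∀ {u v} → ¬ IsSquare u → ¬ IsSquare v → IsSquare (u * v)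
    nonsquare*nonsquare {u} {v} ¬□u ¬□v with IsSquare? (u * v)
    ... | yes □ = □
    ... | no ¬□ = ⊥-elim (1≉-1 (begin
      1#             ≈⟨ solve 0 (con (+ 1) := :- con (+ 1) :* :- con (+ 1)) refl ⟩
      - 1# * - 1#    ≈⟨ *-cong (euler-nonsquare ¬□u) (euler-nonsquare ¬□v) ⟨
      u ^ N * v ^ N  ≈⟨ ^-distrib-* u v N ⟨
      (u * v) ^ N    ≈⟨ euler-nonsquare ¬□ ⟩
      - 1#           ∎))

    √-1-nonsquare : ∀ {j} → j * j ≈ - 1# → ¬ IsSquare j
    √-1-nonsquare {j} j²≈-1 (s , s²≈j) = 1≉-1 (begin
      1#             ≈⟨ euler-square s≉0 ⟨
      (s * s) ^ N    ≈⟨ ^-congˡ N s²≈j ⟩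
      j ^ (h ℕ.+ h)  ≈⟨ ^-double j h ⟩
      (j * j) ^ h    ≈⟨ ^-congˡ h j²≈-1 ⟩
      (- 1#) ^ h     ≈⟨ -1^odd k ⟩
      - 1#           ∎)
      where
      j≉0 : j ≉ 0#
      j≉0 = *-≉0⇒≉0ˡ (λ e → -‿≉0 1≉0 (trans (sym j²≈-1) e))
      s≉0 : s ≉ 0#
      s≉0 = *-≉0⇒≉0ˡ (λ e → j≉0 (trans (sym s²≈j) e))

module Descent {c ℓ} (K : Field c ℓ) where
  open Field K
  open FieldDefs K
  open FieldProperties K
  open ℤ-RingSolver commRing using (solve; _:=_; _:+_; _:*_; _:-_; :-_; con)
  open import Algebra.Properties.Group +-group using (∙-cancelˡ)
  open import Relation.Binary.Reasoning.Setoid setoid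

  Δ : Pair → Carrier
  Δ (α , β) = α * α - β * β

  _±_ : Carrier → Carrier → Pair
  α ± t = α + t , α - t

  S-swap : ∀ {α β} → S (α , β) → S (β , α)
  S-swap {α} {β} (α≉0 , β≉0 , α+β≉0 , α-β≉0) =
    β≉0 , α≉0 , (λ e → α+β≉0 (trans (+-comm α β) e)) ,
    (λ β-α≈0 → α-β≉0 (trans (+-congˡ (-‿cong (x-y≈0⇒x≈y β-α≈0))) (-‿inverseʳ α)))

  ↦-swap : ∀ {α β x} → (α , β) ↦ x → (β , α) ↦ x
  ↦-swap {α} {β} (e₁ , e₂) = trans e₁ (+-comm α β) , trans e₂ (*-comm α β)

  S-resp-≈ₚ : ∀ {x y} → x ≈ₚ y → S x → S y
  S-resp-≈ₚ (α≈γ , β≈δ) (α≉0 , β≉0 , α+β≉0 , α-β≉0) =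
    (λ e → α≉0 (trans α≈γ e)) , (λ e → β≉0 (trans β≈δ e)) ,
    (λ e → α+β≉0 (trans (+-cong α≈γ β≈δ) e)) , (λ e → α-β≉0 (trans (+-cong α≈γ (-‿cong β≈δ)) e))

  ↦-respʳ : ∀ {p x y} → x ≈ₚ y → p ↦ x → p ↦ y
  ↦-respʳ (γ≈γ′ , δ≈δ′) (e₁ , e₂) =
    trans (+-cong (sym γ≈γ′) (sym γ≈γ′)) e₁ , trans (*-cong (sym δ≈δ′) (sym δ≈δ′)) e₂

  Back-resp-≈ₚ : ∀ n {x y} → x ≈ₚ y → Back n x → Back n y
  Back-resp-≈ₚ zero    x≈y (lift Sx)            = lift (S-resp-≈ₚ x≈y Sx)
  Back-resp-≈ₚ (suc n) x≈y (Sx , p , Bp , p↦x) = S-resp-≈ₚ x≈y Sx , p , Bp , ↦-respʳ x≈y p↦x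

  S-↦⇒2≉0 : ∀ {p γ δ} → S p → p ↦ (γ , δ) → 2# ≉ 0#
  S-↦⇒2≉0 {γ = γ} (_ , _ , α+β≉0 , _) (2γ≈α+β , _) 2≈0 = α+β≉0 (begin
    _ + _      ≈⟨ 2γ≈α+β ⟨
    γ + γ      ≈⟨ solve 1 (λ γ → γ :+ γ := con (+ 2) :* γ) refl γ ⟩
    2# * γ     ≈⟨ *-congʳ 2≈0 ⟩
    0# * γ     ≈⟨ zeroˡ γ ⟩
    0#         ∎)

  Δ≉0 : ∀ {x} → S x → Δ x ≉ 0#
  Δ≉0 {α , β} (_ , _ , α+β≉0 , α-β≉0) e = *-≉0 α+β≉0 α-β≉0
    (trans (solve 2 (λ α β → (α :+ β) :* (α :- β) := α :* α :- β :* β) refl α β) e)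

  root≉0 : ∀ {x t} → S x → t * t ≈ Δ x → t ≉ 0#
  root≉0 Sx t²≈Δ = *-≉0⇒≉0ˡ (λ e → Δ≉0 Sx (trans (sym t²≈Δ) e))

  Δ-± : ∀ α t → Δ (α ± t) ≈ (2# * 2#) * (α * t)
  Δ-± = solve 2 (λ α t → (α :+ t) :* (α :+ t) :- (α :- t) :* (α :- t) := (con (+ 2) :* con (+ 2)) :* (α :* t)) refl

  parent-form : ∀ {p α β} → p ↦ (α , β) → ∃ λ t → p ≈ₚ (α ± t) × t * t ≈ Δ (α , β)
  parent-form {a , b} {α} {β} (2α≈a+b , β²≈ab) = t , (a≈α+t , b≈α-t) , (begin
      t * t                      ≈⟨ solve 2 (λ α t → t :* t := α :* α :- (α :+ t) :* (α :- t)) refl α t ⟩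
      α * α - (α + t) * (α - t)  ≈⟨ +-congˡ (-‿cong (*-cong (sym a≈α+t) (sym b≈α-t))) ⟩
      α * α - a * b              ≈⟨ +-congˡ (-‿cong (sym β²≈ab)) ⟩
      α * α - β * β              ∎)
    where
    t : Carrier
    t = a - α
    a≈α+t : a ≈ α + t
    a≈α+t = solve 2 (λ a α → a := α :+ (a :- α)) refl a α
    b≈α-t : b ≈ α - t
    b≈α-t = begin
      b            ≈⟨ solve 2 (λ a b → b := (a :+ b) :- a) refl a b ⟩
      (a + b) - a  ≈⟨ +-congʳ (sym 2α≈a+b) ⟩
      (α + α) - a  ≈⟨ solve 2 (λ a α → (α :+ α) :- a := α :- (a :- α)) refl a α ⟩
      α - t        ∎

  Back₁⇒ : ∀ {x} → Back 1 x → IsSquare (Δ x)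
  Back₁⇒ (_ , _ , _ , p↦x) with t , _ , t²≈Δ ← parent-form p↦x = t , t²≈Δ

  module _ (2≉0 : 2# ≉ 0#) where

    root-parent : ∀ {α β t} → S (α , β) → t * t ≈ Δ (α , β) → Parent (α ± t) (α , β)
    root-parent {α} {β} {t} Sx@(α≉0 , β≉0 , _) t²≈Δ =
      (*-≉0⇒≉0ˡ prod≉0 , *-≉0⇒≉0ʳ prod≉0 , sum≉0 , diff≉0) , Sx , sum≈ , sym prod≈
      where
      prod≈ : (α + t) * (α - t) ≈ β * β
      prod≈ = begin
        (α + t) * (α - t)        ≈⟨ solve 2 (λ α t → (α :+ t) :* (α :- t) := α :* α :- t :* t) refl α t ⟩
        α * α - t * t            ≈⟨ +-congˡ (-‿cong t²≈Δ) ⟩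
        α * α - (α * α - β * β)  ≈⟨ solve 2 (λ α β → α :* α :- (α :* α :- β :* β) := β :* β) refl α β ⟩
        β * β                    ∎
      prod≉0 : (α + t) * (α - t) ≉ 0#
      prod≉0 e = *-≉0 β≉0 β≉0 (trans (sym prod≈) e)
      sum≈ : α + α ≈ (α + t) + (α - t)
      sum≈ = solve 2 (λ α t → α :+ α := (α :+ t) :+ (α :- t)) refl α t
      sum≉0 : (α + t) + (α - t) ≉ 0#
      sum≉0 e = *-≉0 2≉0 α≉0 (trans (solve 1 (λ α → con (+ 2) :* α := α :+ α) refl α) (trans sum≈ e))
      diff≉0 : (α + t) - (α - t) ≉ 0#
      diff≉0 e = *-≉0 2≉0 (root≉0 Sx t²≈Δ)
        (trans (solve 2 (λ α t → con (+ 2) :* t := (α :+ t) :- (α :- t)) refl α t) e)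

    Back₁⇐ : ∀ {x} → S x → IsSquare (Δ x) → Back 1 x
    Back₁⇐ {α , _} Sx (t , t²≈Δ) with Sp , _ , p↦x ← root-parent Sx t²≈Δ = Sx , α ± t , lift Sp , p↦x

    Back₂⇒ : ∀ {α β} → Back 2 (α , β) → ∃ λ t → t * t ≈ Δ (α , β) × IsSquare (α * t)
    Back₂⇒ {α} (_ , _ , Bp , p↦x) with t , p≈α±t , t²≈Δ ← parent-form p↦x =
      t , t²≈Δ , IsSquare-cancelˡ 2≉0 (IsSquare-resp-≈ (Δ-± α t) (Back₁⇒ (Back-resp-≈ₚ 1 p≈α±t Bp)))

    Back₂⇐ : ∀ {α β t} → S (α , β) → t * t ≈ Δ (α , β) → IsSquare (α * t) → Back 2 (α , β)
    Back₂⇐ {α} {t = t} Sx t²≈Δ □αt with Sp , _ , p↦x ← root-parent Sx t²≈Δ =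
      Sx , α ± t , Back₁⇐ Sp (IsSquare-resp-≈ (sym (Δ-± α t)) (IsSquare-* (2# , refl) □αt)) , p↦x

    module _ (_≟_ : Decidable _≈_) where
      open WithDecidableEquality _≟_

      parents : ∀ {α β α′ β′ x} → (α , β) ↦ x → (α′ , β′) ↦ x →
                (α′ , β′) ≈ₚ (α , β) ⊎ (α′ , β′) ≈ₚ (β , α)
      parents {α} {β} {α′} {β′} (e₁ , e₂) (e₁′ , e₂′) with *≈0⇒ (begin
          (α′ - α) * (α′ - β)                   ≈⟨ solve 3 (λ x a b → (x :- a) :* (x :- b) := (x :* x :- x :* (a :+ b)) :+ a :* b) refl α′ α β ⟩
          (α′ * α′ - α′ * (α + β)) + α * β      ≈⟨ +-cong (+-congˡ (-‿cong (*-congˡ (sym sum)))) (sym prod) ⟩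
          (α′ * α′ - α′ * (α′ + β′)) + α′ * β′  ≈⟨ solve 2 (λ x y → (x :* x :- x :* (x :+ y)) :+ x :* y := con (+ 0)) refl α′ β′ ⟩
          0#                                    ∎)
        where
        sum : α′ + β′ ≈ α + β
        sum = trans (sym e₁′) e₁
        prod : α′ * β′ ≈ α * β
        prod = trans (sym e₂′) e₂
      ... | inj₁ α′-α≈0 = let α′≈α = x-y≈0⇒x≈y α′-α≈0 in
        inj₁ (α′≈α , ∙-cancelˡ α β′ β (trans (+-congʳ (sym α′≈α)) (trans (sym e₁′) e₁)))
      ... | inj₂ α′-β≈0 = let α′≈β = x-y≈0⇒x≈y α′-β≈0 in
        inj₂ (α′≈β , ∙-cancelˡ β β′ α (trans (+-congʳ (sym α′≈β)) (trans (sym e₁′) (trans e₁ (+-comm α β)))))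

      module _ (IsSquare? : ∀ x → Dec (IsSquare x))
               (-1-IsSquare : IsSquare (- 1#))
               (nonsquare*nonsquare : ∀ {u v} → ¬ IsSquare u → ¬ IsSquare v → IsSquare (u * v))
               (√-1-nonsquare : ∀ {j} → j * j ≈ - 1# → ¬ IsSquare j) where

        i : Carrier
        i = proj₁ -1-IsSquare

        i²≈-1 : i * i ≈ - 1#
        i²≈-1 = proj₂ -1-IsSquare

        IsSquare-*-root : ∀ {α t t′} → t′ * t′ ≈ t * t → IsSquare (α * t′) → IsSquare (α * t)
        IsSquare-*-root {α} {t} {t′} t′²≈t² □αt′ with square-roots t′²≈t²
        ... | inj₁ t′≈t  = IsSquare-resp-≈ (*-congˡ t′≈t) □αt′
        ... | inj₂ t′≈-t = IsSquare-resp-≈ (begin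
          (i * i) * (α * t′)  ≈⟨ *-cong i²≈-1 (*-congˡ t′≈-t) ⟩
          - 1# * (α * - t)    ≈⟨ solve 2 (λ α t → :- con (+ 1) :* (α :* :- t) := α :* t) refl α t ⟩
          α * t               ∎) (IsSquare-* (i , refl) □αt′)

        Back₂⇒IsSquare : ∀ {α β t} → t * t ≈ Δ (α , β) → Back 2 (α , β) → IsSquare (α * t)
        Back₂⇒IsSquare t²≈Δ B with _ , t′²≈Δ , □αt′ ← Back₂⇒ B = IsSquare-*-root (trans t′²≈Δ (sym t²≈Δ)) □αt′

        swap-root : ∀ {α β t} → t * t ≈ Δ (α , β) → (i * t) * (i * t) ≈ Δ (β , α)
        swap-root {α} {β} {t} t²≈Δ = begin
          (i * t) * (i * t)       ≈⟨ solve 2 (λ i t → (i :* t) :* (i :* t) := (i :* i) :* (t :* t)) refl i t ⟩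
          (i * i) * (t * t)       ≈⟨ *-cong i²≈-1 t²≈Δ ⟩
          - 1# * (α * α - β * β)  ≈⟨ solve 2 (λ α β → :- con (+ 1) :* (α :* α :- β :* β) := β :* β :- α :* α) refl α β ⟩
          β * β - α * α           ∎

        not-both : ∀ {α β γ δ t} → (α , β) ↦ (γ , δ) → δ ≉ 0# → t ≉ 0# →
                   ¬ IsSquare ((α * t) * (β * (i * t)))
        not-both {α} {β} {γ} {δ} {t} (_ , δ²≈αβ) δ≉0 t≉0 □ =
          √-1-nonsquare i²≈-1 (IsSquare-cancelˡ (*-≉0 δ≉0 t≉0) (IsSquare-resp-≈ (begin
            (α * t) * (β * (i * t))  ≈⟨ solve 4 (λ α β i t → (α :* t) :* (β :* (i :* t)) := ((α :* β) :* (t :* t)) :* i) refl α β i t ⟩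
            ((α * β) * (t * t)) * i  ≈⟨ *-congʳ (*-congʳ (sym δ²≈αβ)) ⟩
            ((δ * δ) * (t * t)) * i  ≈⟨ solve 3 (λ δ t i → ((δ :* δ) :* (t :* t)) :* i := ((δ :* t) :* (δ :* t)) :* i) refl δ t i ⟩
            ((δ * t) * (δ * t)) * i  ∎) □))

        unique-parent-in-Back₂ : ∀ {x} → Back 2 x →
          Σ Pair λ p → (Parent p x × Back 2 p) × (∀ p′ → Parent p′ x → Back 2 p′ → p′ ≈ₚ p)
        unique-parent-in-Back₂ {x} (Sx@(_ , δ≉0 , _) , (α , β) , B₁y@(Sy , _) , y↦x)
          with t , t²≈Δ ← Back₁⇒ B₁y | IsSquare? (α * t)
        ... | yes □αt = (α , β) , ((Sy , Sx , y↦x) , Back₂⇐ Sy t²≈Δ □αt) , only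
          where
          only : ∀ p′ → Parent p′ x → Back 2 p′ → p′ ≈ₚ (α , β)
          only p′ (_ , _ , p′↦x) B₂p′ with parents y↦x p′↦x
          ... | inj₁ p′≈αβ = p′≈αβ
          ... | inj₂ p′≈βα = ⊥-elim (not-both y↦x δ≉0 (root≉0 Sy t²≈Δ)
                  (IsSquare-* □αt (Back₂⇒IsSquare (swap-root t²≈Δ) (Back-resp-≈ₚ 2 p′≈βα B₂p′))))
        ... | no ¬□αt = (β , α) , ((S-swap Sy , Sx , ↦-swap y↦x) , Back₂⇐ (S-swap Sy) (swap-root t²≈Δ) □βit) , only
          where
          □βit : IsSquare (β * (i * t))
          □βit with IsSquare? (β * (i * t))
          ... | yes □ = □
          ... | no ¬□ = ⊥-elim (not-both y↦x δ≉0 (root≉0 Sy t²≈Δ) (nonsquare*nonsquare ¬□αt ¬□))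
          only : ∀ p′ → Parent p′ x → Back 2 p′ → p′ ≈ₚ (β , α)
          only p′ (_ , _ , p′↦x) B₂p′ with parents y↦x p′↦x
          ... | inj₁ p′≈αβ = ⊥-elim (¬□αt (Back₂⇒IsSquare t²≈Δ (Back-resp-≈ₚ 2 p′≈αβ B₂p′)))
          ... | inj₂ p′≈βα = p′≈βα

open ≡ using (setoid)

lemma4p4 : ∀ {c ℓ} (K : Field c ℓ) (q : ℕ) → IsPrimePower q → q % 8 ≡ 5
         → Inverse (setoid (Fin q)) (Field.setoid K)
         → let open FieldDefs K in
           ∀ (x : Pair) → Back 2 x
         → Σ Pair (λ p → (Parent p x × Back 2 p)
              × (∀ p′ → Parent p′ x → Back 2 p′ → p′ ≈ₚ p))
lemma4p4 K q _ q%8≡5 enum x x∈Back₂@(_ , _ , (Sy , _) , y↦x) =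
  unique-parent-in-Back₂ 2≉0 _≟_ IsSquare? -1-IsSquare nonsquare*nonsquare √-1-nonsquare x∈Back₂
  where
  open Field K using (_≉_; 0#)
  open FieldProperties K using (2#)
  open Descent K
  open FiniteField K enum
  2≉0 : 2# ≉ 0#
  2≉0 = S-↦⇒2≉0 Sy y↦x
  q≡5+8k : q ≡ 5 ℕ.+ (q / 8) ℕ.* 8
  q≡5+8k = ≡.trans (m≡m%n+[m/n]*n q 8) (≡.cong (ℕ._+ (q / 8) ℕ.* 8) q%8≡5)
  open Order≡5mod8 2≉0 (q / 8) q≡5+8k
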